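{- For every $n\ge2$ there is a bijection $\varphi:\mathcal{A}_n\cap\mathcal{G}\to\mathcal{A}_{n-1}$ such that for all $s\in\mathcal{A}_n\cap\mathcal{G}$: $\mathsf{zero}(\varphi(s))=\mathsf{zero}(s)-1$, $\mathsf{asc}(\varphi(s))=\mathsf{asc}(s)$ and $\mathsf{zpair}(\varphi(s))=\mathsf{zpair}(s)$.
   Context: An inversion sequence of length $n$ is $s=(s_1,\dots,s_n)$ with $0\le s_i<i$. $\mathsf{asc}(s)=|\{i\in[n-1]:s_i<s_{i+1}\}|$; $\mathsf{zero}(s)=|\{i:s_i=0\}|$. An ascent sequence is an inversion sequence with $s_i\le\mathsf{asc}(s_1,\dots,s_{i-1})+1$ for $2\le i\le n$; $\mathcal{A}_n$ is the set of ascent sequences of length $n$, $\mathcal{A}$ the set of all of them. For $s\in\mathcal{A}_n\setminus\{(0,\dots,0)\}$, index the zeros of $s$ left to right starting at $0$, the $i$-th at position $k_i$, and let $\mathsf{zpair}(s)=\max\{0\le i\le\mathsf{zero}(s)-1:s_{k_i+1}=1\}$; set $\mathsf{zpair}(0,\dots,0)=0$. $\mathcal{G}$ is the set of $s\in\mathcal{A}$ with $\mathsf{zpair}(s)<\mathsf{zero}(s)-1$ such that the $(\mathsf{zpair}(s)+1)$-th zero is either the last entry of $s$ or is immediately followed by a zero. -}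

module Defs where

open import Data.Nat using (ℕ; zero; suc; _+_; _∸_; _<ᵇ_; _≤ᵇ_; _≡ᵇ_)
open import Data.Bool using (Bool; true; false; _∧_; if_then_else_; T)
open import Data.List using (List; []; _∷_; length)
open import Data.Maybe using (Maybe; just; nothing)
open import Data.Vec using (Vec; toList)
open import Data.Product using (Σ)

-- Sequences are lists of naturals s = (s_1, …, s_n); positions below are 0-indexed.

asc : List ℕ → ℕ
asc (x ∷ y ∷ r) = (if x <ᵇ y then 1 else 0) + asc (y ∷ r)
asc _ = 0

zeroCount : List ℕ → ℕ
zeroCount [] = 0
zeroCount (x ∷ r) = (if x ≡ᵇ 0 then 1 else 0) + zeroCount r

-- Ascent-sequence check.  ascCheck i a p r : the remaining entries r start at
-- (1-indexed) position i+1, the prefix has asc = a and last entry p.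
-- Each entry x at 1-indexed position j = i+1 must satisfy x < j (inversion
-- sequence) and x ≤ asc(prefix) + 1.
ascCheck : ℕ → ℕ → ℕ → List ℕ → Bool
ascCheck i a p [] = true
ascCheck i a p (x ∷ r) =
  (x <ᵇ suc i) ∧ (x ≤ᵇ suc a) ∧ ascCheck (suc i) (if p <ᵇ x then suc a else a) x r

-- s is an ascent sequence (in particular an inversion sequence, so s_1 = 0)
isAscent : List ℕ → Bool
isAscent [] = true
isAscent (x ∷ r) = (x ≡ᵇ 0) ∧ ascCheck 1 0 x r

entryAt : List ℕ → ℕ → Maybe ℕ
entryAt [] k = nothing
entryAt (x ∷ r) zero = just x
entryAt (x ∷ r) (suc k) = entryAt r k

zeroPosFrom : ℕ → List ℕ → List ℕ
zeroPosFrom j [] = []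
zeroPosFrom j (x ∷ r) =
  if x ≡ᵇ 0 then j ∷ zeroPosFrom (suc j) r else zeroPosFrom (suc j) r

zeroPositions : List ℕ → List ℕ
zeroPositions = zeroPosFrom 0

followedByOne : List ℕ → ℕ → Bool
followedByOne s k with entryAt s (suc k)
... | just v = v ≡ᵇ 1
... | nothing = false

-- largest index i (counting the zeros from 0) such that s_{k_i + 1} = 1;
-- the accumulator `best` starts at 0, which is the value for the all-zero
-- sequence (and the max is over a nonempty set for any other ascent sequence).
zpairGo : List ℕ → ℕ → ℕ → List ℕ → ℕ
zpairGo s i best [] = best
zpairGo s i best (k ∷ ks) =
  zpairGo s (suc i) (if followedByOne s k then i else best) ks

zpair : List ℕ → ℕ
zpair s = zpairGo s 0 0 (zeroPositions s)

lastOrFollowedByZero : List ℕ → ℕ → Bool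
lastOrFollowedByZero s k with entryAt s (suc k)
... | just v = v ≡ᵇ 0
... | nothing = true

-- membership in 𝒢: zpair(s) < zero(s) - 1 and the (zpair(s)+1)-th zero
-- (0-indexed from the left) is the last entry or followed by a zero
inG : List ℕ → Bool
inG s with entryAt (zeroPositions s) (suc (zpair s))
... | just k = (suc (zpair s) <ᵇ zeroCount s) ∧ lastOrFollowedByZero s k
... | nothing = false

AscSeq : ℕ → Set
AscSeq n = Σ (Vec ℕ n) (λ v → T (isAscent (toList v)))

AscSeqG : ℕ → Set
AscSeqG n = Σ (Vec ℕ n) (λ v → T (isAscent (toList v) ∧ inG (toList v)))

-- φ deletes the (zpair+1)-th zero of s, which the definition of 𝒢 makes either the last entry
-- or the first half of a factor 00.  Deleting such a zero creates no ascent and removes none,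
-- keeps every entry bounded by 1 + (ascents before it), and does not touch the zeros followed
-- by a 1, so asc and zpair survive while zero drops by one.  Conversely, doubling the
-- (zpair+1)-th zero of an ascent sequence (or appending a zero if there is none) lands in 𝒢.
module Submission where

open import Defs
open import Data.Nat using (ℕ; zero; suc; _+_; _∸_; _<ᵇ_; _≤ᵇ_; _≡ᵇ_; _≤_; _<_; z≤n; s≤s; pred)
open import Data.Nat.Properties using (+-suc; +-identityʳ; <⇒<ᵇ; ≤ᵇ⇒≤; ≤-trans; n≤1+n; <ᵇ⇒<; n<1+n; <⇒≯; <-irrefl)
open import Data.Bool using (Bool; true; false; _∧_; if_then_else_; T)
open import Data.Bool.Properties using (∧-zeroʳ; T-irrelevant; T-∧; T-≡)
open import Relation.Nullary using (contradiction)
open import Function.Base using (_∘_)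
open import Data.List using (List; []; _∷_; length; head; drop)
open import Data.Maybe using (Maybe; just; nothing; maybe; fromMaybe; _<∣>_)
open import Data.Maybe.Properties using (just-injective)
import Data.Maybe as Maybe
open import Data.Product using (Σ; _,_; _×_; proj₁; proj₂)
open import Data.Unit using (tt)
open import Data.Vec using (Vec; toList; fromList; cast)
open import Data.Vec.Properties using (toList-cast; toList∘fromList; toList-injective; length-toList; cast-is-id)
open import Function.Bundles using (_⤖_; Bijection; Equivalence; mk↔ₛ′)
open import Function.Properties.Inverse using (↔⇒⤖)
open import Relation.Binary.PropositionalEquality
open ≡-Reasoning

startsWithOne : List ℕ → Bool
startsWithOne r = maybe (_≡ᵇ 1) false (head r)

emptyOrStartsWithZero : List ℕ → Bool
emptyOrStartsWithZero r = maybe (_≡ᵇ 0) true (head r)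

entryAt≡head∘drop : ∀ s k → entryAt s k ≡ head (drop k s)
entryAt≡head∘drop []      zero    = refl
entryAt≡head∘drop []      (suc k) = refl
entryAt≡head∘drop (x ∷ s) zero    = refl
entryAt≡head∘drop (x ∷ s) (suc k) = entryAt≡head∘drop s k

drop-suc : ∀ (s : List ℕ) j {x r} → drop j s ≡ x ∷ r → drop (suc j) s ≡ r
drop-suc (x ∷ s) zero    refl = refl
drop-suc (x ∷ s) (suc j) e    = drop-suc s j e

entryAt-next : ∀ s j {x r} → drop j s ≡ x ∷ r → entryAt s (suc j) ≡ head r
entryAt-next s j e = trans (entryAt≡head∘drop s (suc j)) (cong head (drop-suc s j e))

followedByOne-drop : ∀ s j {x r} → drop j s ≡ x ∷ r → followedByOne s j ≡ startsWithOne r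
followedByOne-drop s j e = trans unfold (cong (maybe (_≡ᵇ 1) false) (entryAt-next s j e))
  where
  unfold : followedByOne s j ≡ maybe (_≡ᵇ 1) false (entryAt s (suc j))
  unfold with entryAt s (suc j)
  ... | just v  = refl
  ... | nothing = refl

lastOrFollowedByZero-drop : ∀ s j {x r} → drop j s ≡ x ∷ r →
  lastOrFollowedByZero s j ≡ emptyOrStartsWithZero r
lastOrFollowedByZero-drop s j e = trans unfold (cong (maybe (_≡ᵇ 0) true) (entryAt-next s j e))
  where
  unfold : lastOrFollowedByZero s j ≡ maybe (_≡ᵇ 0) true (entryAt s (suc j))
  unfold with entryAt s (suc j)
  ... | just v  = refl
  ... | nothing = refl

-- Ascent sequences without the inversion-sequence bound s_i < i, which is implied:
-- s_i ≤ 1 + (ascents among the first i − 1 entries) ≤ i − 1.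
ascCheck′ : ℕ → ℕ → List ℕ → Bool
ascCheck′ a p []      = true
ascCheck′ a p (x ∷ r) = (x ≤ᵇ suc a) ∧ ascCheck′ (if p <ᵇ x then suc a else a) x r

isAscent′ : List ℕ → Bool
isAscent′ []      = true
isAscent′ (x ∷ r) = (x ≡ᵇ 0) ∧ ascCheck′ 0 x r

ascCheck≡ascCheck′ : ∀ i a p r → suc a ≤ i → ascCheck i a p r ≡ ascCheck′ a p r
ascCheck≡ascCheck′ i a p []      a<i = refl
ascCheck≡ascCheck′ i a p (x ∷ r) a<i with x ≤ᵇ suc a in x≤1+a
... | false = ∧-zeroʳ (x <ᵇ suc i)
... | true  = cong₂ _∧_ x<1+i (ascCheck≡ascCheck′ (suc i) _ x r (a′<1+i (p <ᵇ x)))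
  where
  x<1+i : (x <ᵇ suc i) ≡ true
  x<1+i = Equivalence.to T-≡ (<⇒<ᵇ (s≤s (≤-trans (≤ᵇ⇒≤ x (suc a) (Equivalence.from T-≡ x≤1+a)) a<i)))

  a′<1+i : ∀ b → suc (if b then suc a else a) ≤ suc i
  a′<1+i true  = s≤s a<i
  a′<1+i false = ≤-trans a<i (n≤1+n i)

isAscent≡isAscent′ : ∀ s → isAscent s ≡ isAscent′ s
isAscent≡isAscent′ []      = refl
isAscent≡isAscent′ (x ∷ r) = cong ((x ≡ᵇ 0) ∧_) (ascCheck≡ascCheck′ 1 0 x r (s≤s z≤n))

-- nothing when no zero is followed by a 1, the case where zpair defaults to 0.
lastZeroBeforeOne : List ℕ → Maybe ℕ
lastZeroBeforeOne []          = nothing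
lastZeroBeforeOne (suc x ∷ r) = lastZeroBeforeOne r
lastZeroBeforeOne (zero ∷ r)  =
  Maybe.map suc (lastZeroBeforeOne r) <∣> (if startsWithOne r then just 0 else nothing)

zpair′ : List ℕ → ℕ
zpair′ s = fromMaybe 0 (lastZeroBeforeOne s)

zpairGo-drop : ∀ s i b j r → drop j s ≡ r →
  zpairGo s i b (zeroPosFrom j r) ≡ maybe (i +_) b (lastZeroBeforeOne r)
zpairGo-drop s i b j []          e = refl
zpairGo-drop s i b j (suc x ∷ r) e = zpairGo-drop s i b (suc j) r (drop-suc s j e)
zpairGo-drop s i b j (zero ∷ r)  e = begin
  zpairGo s (suc i) (if followedByOne s j then i else b) (zeroPosFrom (suc j) r)
    ≡⟨ cong (λ c → zpairGo s (suc i) (if c then i else b) (zeroPosFrom (suc j) r))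
            (followedByOne-drop s j e) ⟩
  zpairGo s (suc i) (if startsWithOne r then i else b) (zeroPosFrom (suc j) r)
    ≡⟨ zpairGo-drop s (suc i) _ (suc j) r (drop-suc s j e) ⟩
  maybe (suc i +_) (if startsWithOne r then i else b) (lastZeroBeforeOne r)
    ≡⟨ shift (lastZeroBeforeOne r) (startsWithOne r) ⟩
  maybe (i +_) b (lastZeroBeforeOne (zero ∷ r))
    ∎
  where
  shift : ∀ m c → maybe (suc i +_) (if c then i else b) m
                ≡ maybe (i +_) b (Maybe.map suc m <∣> (if c then just 0 else nothing))
  shift (just v) c     = sym (+-suc i v)
  shift nothing  true  = sym (+-identityʳ i)
  shift nothing  false = refl

zpair≡zpair′ : ∀ s → zpair s ≡ zpair′ s
zpair≡zpair′ s = zpairGo-drop s 0 0 0 s refl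

zeroDoubled : ℕ → List ℕ → Bool
zeroDoubled j       []          = false
zeroDoubled j       (suc x ∷ r) = zeroDoubled j r
zeroDoubled zero    (zero ∷ r)  = emptyOrStartsWithZero r
zeroDoubled (suc j) (zero ∷ r)  = zeroDoubled j r

zeroPosFrom-entryAt : ∀ s j r m → drop j s ≡ r →
  maybe (lastOrFollowedByZero s) false (entryAt (zeroPosFrom j r) m) ≡ zeroDoubled m r
zeroPosFrom-entryAt s j []          m       e = refl
zeroPosFrom-entryAt s j (suc x ∷ r) m       e = zeroPosFrom-entryAt s (suc j) r m (drop-suc s j e)
zeroPosFrom-entryAt s j (zero ∷ r)  zero    e = lastOrFollowedByZero-drop s j e
zeroPosFrom-entryAt s j (zero ∷ r)  (suc m) e = zeroPosFrom-entryAt s (suc j) r m (drop-suc s j e)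

zeroPosFrom-entryAt-< : ∀ j r m {k} → entryAt (zeroPosFrom j r) m ≡ just k →
  (m <ᵇ zeroCount r) ≡ true
zeroPosFrom-entryAt-< j (suc x ∷ r) m       e = zeroPosFrom-entryAt-< (suc j) r m e
zeroPosFrom-entryAt-< j (zero ∷ r)  zero    e = refl
zeroPosFrom-entryAt-< j (zero ∷ r)  (suc m) e = zeroPosFrom-entryAt-< (suc j) r m e

inG≡zeroDoubled : ∀ s → inG s ≡ zeroDoubled (suc (zpair′ s)) s
inG≡zeroDoubled s = trans inG≡ (cong (λ z → zeroDoubled (suc z) s) (zpair≡zpair′ s))
  where
  m = suc (zpair s)
  entry = zeroPosFrom-entryAt s 0 s m refl

  inG≡ : inG s ≡ zeroDoubled m s
  inG≡ with entryAt (zeroPositions s) m in e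
  ... | just k  = cong₂ _∧_ (zeroPosFrom-entryAt-< 0 s m e)
                            (trans (cong (maybe _ false) (sym e)) entry)
  ... | nothing = trans (cong (maybe _ false) (sym e)) entry

data DropZero : ℕ → List ℕ → List ℕ → Set where
  here  : ∀ {r} → T (emptyOrStartsWithZero r) → DropZero 0 (zero ∷ r) r
  skip₀ : ∀ {j r t} → DropZero j r t → DropZero (suc j) (zero ∷ r) (zero ∷ t)
  skip₊ : ∀ {j x r t} → DropZero j r t → DropZero j (suc x ∷ r) (suc x ∷ t)

dropZero : ℕ → List ℕ → List ℕ
dropZero j       []          = []
dropZero j       (suc x ∷ r) = suc x ∷ dropZero j r
dropZero zero    (zero ∷ r)  = r
dropZero (suc j) (zero ∷ r)  = zero ∷ dropZero j r

insertZero : ℕ → List ℕ → List ℕ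
insertZero j       []          = zero ∷ []
insertZero j       (suc x ∷ r) = suc x ∷ insertZero j r
insertZero zero    (zero ∷ r)  = zero ∷ zero ∷ r
insertZero (suc j) (zero ∷ r)  = zero ∷ insertZero j r

zeroDoubled⇒DropZero : ∀ j s → T (zeroDoubled j s) → DropZero j s (dropZero j s)
zeroDoubled⇒DropZero j       (suc x ∷ r) d = skip₊ (zeroDoubled⇒DropZero j r d)
zeroDoubled⇒DropZero zero    (zero ∷ r)  d = here d
zeroDoubled⇒DropZero (suc j) (zero ∷ r)  d = skip₀ (zeroDoubled⇒DropZero j r d)

DropZero⇒zeroDoubled : ∀ {j s t} → DropZero j s t → T (zeroDoubled j s)
DropZero⇒zeroDoubled (here d)  = d
DropZero⇒zeroDoubled (skip₀ d) = DropZero⇒zeroDoubled d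
DropZero⇒zeroDoubled (skip₊ d) = DropZero⇒zeroDoubled d

DropZero⇒dropZero : ∀ {j s t} → DropZero j s t → dropZero j s ≡ t
DropZero⇒dropZero (here d)  = refl
DropZero⇒dropZero (skip₀ d) = cong (zero ∷_) (DropZero⇒dropZero d)
DropZero⇒dropZero (skip₊ d) = cong (suc _ ∷_) (DropZero⇒dropZero d)

DropZero⇒insertZero : ∀ {j s t} → DropZero j s t → insertZero j t ≡ s
DropZero⇒insertZero (here {[]} d)       = refl
DropZero⇒insertZero (here {zero ∷ r} d) = refl
DropZero⇒insertZero (skip₀ d)           = cong (zero ∷_) (DropZero⇒insertZero d)
DropZero⇒insertZero (skip₊ d)           = cong (suc _ ∷_) (DropZero⇒insertZero d)

insertZero-DropZero : ∀ j t → j ≤ zeroCount t → DropZero j (insertZero j t) t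
insertZero-DropZero zero    []          _        = here tt
insertZero-DropZero j       (suc x ∷ r) j≤       = skip₊ (insertZero-DropZero j r j≤)
insertZero-DropZero zero    (zero ∷ r)  _        = here tt
insertZero-DropZero (suc j) (zero ∷ r)  (s≤s j≤) = skip₀ (insertZero-DropZero j r j≤)

DropZero-zeroCount : ∀ {j s t} → DropZero j s t → zeroCount s ≡ suc (zeroCount t)
DropZero-zeroCount (here d)  = refl
DropZero-zeroCount (skip₀ d) = cong suc (DropZero-zeroCount d)
DropZero-zeroCount (skip₊ d) = DropZero-zeroCount d

DropZero-length : ∀ {j s t} → DropZero j s t → length s ≡ suc (length t)
DropZero-length (here d)  = refl
DropZero-length (skip₀ d) = cong suc (DropZero-length d)
DropZero-length (skip₊ d) = cong suc (DropZero-length d)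

DropZero-startsWithOne : ∀ {j s t} → DropZero j s t → startsWithOne s ≡ startsWithOne t
DropZero-startsWithOne (here {[]} d)       = refl
DropZero-startsWithOne (here {zero ∷ r} d) = refl
DropZero-startsWithOne (skip₀ d)           = refl
DropZero-startsWithOne (skip₊ d)           = refl

DropZero-ascCheck′ : ∀ {j s t} → DropZero j s t → ∀ a p → ascCheck′ a p s ≡ ascCheck′ a p t
DropZero-ascCheck′ (here {[]} d)       a p = refl
DropZero-ascCheck′ (here {zero ∷ r} d) a p = refl
DropZero-ascCheck′ (skip₀ d)           a p = DropZero-ascCheck′ d a zero
DropZero-ascCheck′ (skip₊ {x = x} d)   a p =
  cong ((suc x ≤ᵇ suc a) ∧_) (DropZero-ascCheck′ d _ (suc x))

DropZero-isAscent : ∀ {j s t} → DropZero j s t → isAscent s ≡ isAscent t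
DropZero-isAscent {s = s} {t} d = begin
  isAscent s   ≡⟨ isAscent≡isAscent′ s ⟩
  isAscent′ s  ≡⟨ isAscent′-≡ d ⟩
  isAscent′ t  ≡⟨ isAscent≡isAscent′ t ⟨
  isAscent t   ∎
  where
  isAscent′-≡ : ∀ {j s t} → DropZero j s t → isAscent′ s ≡ isAscent′ t
  isAscent′-≡ (here {[]} d)       = refl
  isAscent′-≡ (here {zero ∷ r} d) = refl
  isAscent′-≡ (skip₀ d)           = DropZero-ascCheck′ d 0 0
  isAscent′-≡ (skip₊ d)           = refl

DropZero-asc-∷ : ∀ {j s t} → DropZero j s t → ∀ p → asc (p ∷ s) ≡ asc (p ∷ t)
DropZero-asc-∷ (here {[]} d)       p = refl
DropZero-asc-∷ (here {zero ∷ r} d) p = refl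
DropZero-asc-∷ (skip₀ d)           p = cong ((if p <ᵇ 0 then 1 else 0) +_) (DropZero-asc-∷ d 0)
DropZero-asc-∷ (skip₊ {x = x} d)   p =
  cong ((if p <ᵇ suc x then 1 else 0) +_) (DropZero-asc-∷ d (suc x))

DropZero-asc : ∀ {j s t} → DropZero j s t → asc s ≡ asc t
DropZero-asc (here {[]} d)       = refl
DropZero-asc (here {zero ∷ r} d) = refl
DropZero-asc (skip₀ d)           = DropZero-asc-∷ d 0
DropZero-asc (skip₊ d)           = DropZero-asc-∷ d (suc _)

-- The index, among the zeros left after deleting the j-th one, of the former v-th zero (v ≠ j).
indexAfterDrop : ℕ → ℕ → ℕ
indexAfterDrop j v = if j <ᵇ v then pred v else v

indexAfterDrop-suc : ∀ j v → suc (indexAfterDrop j v) ≡ indexAfterDrop (suc j) (suc v)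
indexAfterDrop-suc j       zero    = refl
indexAfterDrop-suc zero    (suc v) = refl
indexAfterDrop-suc (suc j) (suc v) with j <ᵇ v
... | true  = refl
... | false = refl

DropZero-lastZeroBeforeOne : ∀ {j s t} → DropZero j s t →
  lastZeroBeforeOne t ≡ Maybe.map (indexAfterDrop j) (lastZeroBeforeOne s)
DropZero-lastZeroBeforeOne (here {[]} d) = refl
DropZero-lastZeroBeforeOne (here {zero ∷ r} d) with lastZeroBeforeOne (zero ∷ r)
... | just v  = refl
... | nothing = refl
DropZero-lastZeroBeforeOne (skip₀ {j} {r} {t} d)
  rewrite DropZero-startsWithOne d | DropZero-lastZeroBeforeOne d
  with lastZeroBeforeOne r | startsWithOne t
... | just v  | _     = cong just (indexAfterDrop-suc j v)
... | nothing | true  = refl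
... | nothing | false = refl
DropZero-lastZeroBeforeOne (skip₊ d) = DropZero-lastZeroBeforeOne d

indexAfterDrop-below : ∀ {j v} → v < j → indexAfterDrop j v ≡ v
indexAfterDrop-below {j} {v} v<j with j <ᵇ v in j<v
... | false = refl
... | true  = contradiction (<ᵇ⇒< j v (Equivalence.from T-≡ j<v)) (<⇒≯ v<j)

indexAfterDrop-fixed : ∀ z v → indexAfterDrop (suc z) v ≡ z → v ≡ z
indexAfterDrop-fixed z zero    e = e
indexAfterDrop-fixed z (suc v) e with z <ᵇ v in z<v
... | false = e
... | true  = contradiction (<ᵇ⇒< z v (Equivalence.from T-≡ z<v)) (<-irrefl (sym e))

DropZero-zpair′ : ∀ {s t} → DropZero (suc (zpair′ s)) s t → zpair′ t ≡ zpair′ s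
DropZero-zpair′ {s} d with lastZeroBeforeOne s | DropZero-lastZeroBeforeOne d
... | just v  | e rewrite e = indexAfterDrop-below (n<1+n v)
... | nothing | e rewrite e = refl

DropZero-zpair′⁻¹ : ∀ {s t} → DropZero (suc (zpair′ t)) s t → zpair′ s ≡ zpair′ t
DropZero-zpair′⁻¹ {s} {t} d with lastZeroBeforeOne s | lastZeroBeforeOne t | DropZero-lastZeroBeforeOne d
... | nothing | nothing | _ = refl
... | just v  | just z  | e = indexAfterDrop-fixed z v (sym (just-injective e))

lastZeroBeforeOne-< : ∀ t {v} → lastZeroBeforeOne t ≡ just v → v < zeroCount t
lastZeroBeforeOne-< (suc x ∷ r) e = lastZeroBeforeOne-< r e
lastZeroBeforeOne-< (zero ∷ r)  e with lastZeroBeforeOne r in e′ | startsWithOne r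
lastZeroBeforeOne-< (zero ∷ r) refl | just v  | _    = s≤s (lastZeroBeforeOne-< r e′)
lastZeroBeforeOne-< (zero ∷ r) refl | nothing | true = s≤s z≤n

zpair′-< : ∀ r → zpair′ (zero ∷ r) < zeroCount (zero ∷ r)
zpair′-< r with lastZeroBeforeOne (zero ∷ r) in e
... | just v  = lastZeroBeforeOne-< (zero ∷ r) e
... | nothing = s≤s z≤n

φ : List ℕ → List ℕ
φ s = dropZero (suc (zpair′ s)) s

φ⁻¹ : List ℕ → List ℕ
φ⁻¹ t = insertZero (suc (zpair′ t)) t

DropZero-φ : ∀ s → T (inG s) → DropZero (suc (zpair′ s)) s (φ s)
DropZero-φ s g = zeroDoubled⇒DropZero _ s (subst T (inG≡zeroDoubled s) g)

DropZero-φ⁻¹ : ∀ r → DropZero (suc (zpair′ (φ⁻¹ (zero ∷ r)))) (φ⁻¹ (zero ∷ r)) (zero ∷ r)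
DropZero-φ⁻¹ r = subst (λ z → DropZero (suc z) (φ⁻¹ t) t) (sym (DropZero-zpair′⁻¹ d)) d
  where
  t = zero ∷ r
  d = insertZero-DropZero _ t (zpair′-< r)

φ-into : ∀ k s → length s ≡ suc (suc k) → T (isAscent s ∧ inG s) →
  length (φ s) ≡ suc k × T (isAscent (φ s))
φ-into k s len a∧g = cong pred (trans (sym (DropZero-length d)) len) , subst T (DropZero-isAscent d) a
  where
  a = proj₁ (Equivalence.to T-∧ a∧g)
  d = DropZero-φ s (proj₂ (Equivalence.to T-∧ a∧g))

φ⁻¹-into : ∀ k t → length t ≡ suc k → T (isAscent t) →
  length (φ⁻¹ t) ≡ suc (suc k) × T (isAscent (φ⁻¹ t) ∧ inG (φ⁻¹ t))
φ⁻¹-into k (zero ∷ r) len a =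
  trans (DropZero-length d) (cong suc len) ,
  Equivalence.from T-∧ ( subst T (sym (DropZero-isAscent d)) a
                       , subst T (sym (inG≡zeroDoubled (φ⁻¹ (zero ∷ r)))) (DropZero⇒zeroDoubled d))
  where
  d = DropZero-φ⁻¹ r

φ⁻¹∘φ : ∀ s → T (isAscent s ∧ inG s) → φ⁻¹ (φ s) ≡ s
φ⁻¹∘φ s a∧g = begin
  insertZero (suc (zpair′ (φ s))) (φ s)  ≡⟨ cong (λ z → insertZero (suc z) (φ s)) (DropZero-zpair′ d) ⟩
  insertZero (suc (zpair′ s)) (φ s)      ≡⟨ DropZero⇒insertZero d ⟩
  s                                      ∎
  where
  d = DropZero-φ s (proj₂ (Equivalence.to T-∧ a∧g))

φ∘φ⁻¹ : ∀ k t → length t ≡ suc k → T (isAscent t) → φ (φ⁻¹ t) ≡ t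
φ∘φ⁻¹ k (zero ∷ r) len a = DropZero⇒dropZero (DropZero-φ⁻¹ r)

DropZero-statistics : ∀ {s t} → DropZero (suc (zpair′ s)) s t →
  (zeroCount t ≡ zeroCount s ∸ 1) × (asc t ≡ asc s) × (zpair t ≡ zpair s)
DropZero-statistics {s} {t} d =
  cong pred (sym (DropZero-zeroCount d)) ,
  sym (DropZero-asc d) ,
  (begin
    zpair t   ≡⟨ zpair≡zpair′ t ⟩
    zpair′ t  ≡⟨ DropZero-zpair′ d ⟩
    zpair′ s  ≡⟨ zpair≡zpair′ s ⟨
    zpair s   ∎)

VecWith : ℕ → (List ℕ → Bool) → Set
VecWith n P = Σ (Vec ℕ n) (λ v → T (P (toList v)))

toList-cast-fromList : ∀ {n} (l : List ℕ) (len : length l ≡ n) → toList (cast len (fromList l)) ≡ l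
toList-cast-fromList l len = trans (toList-cast len (fromList l)) (toList∘fromList l)

module _ (P : List ℕ → Bool) where

  fromListWith : ∀ {n} l → length l ≡ n → T (P l) → VecWith n P
  fromListWith l len p = cast len (fromList l) , subst (T ∘ P) (sym (toList-cast-fromList l len)) p

  VecWith-≡ : ∀ {n} {u w : VecWith n P} → toList (proj₁ u) ≡ toList (proj₁ w) → u ≡ w
  VecWith-≡ {u = v , p} {w , q} e
    with trans (sym (cast-is-id refl v)) (toList-injective refl v w e)
  ... | refl = cong (v ,_) (T-irrelevant p q)

module LiftToVec {m n} {P Q : List ℕ → Bool} (f g : List ℕ → List ℕ)
  (f-into : ∀ l → length l ≡ m → T (P l) → length (f l) ≡ n × T (Q (f l)))
  (g-into : ∀ l → length l ≡ n → T (Q l) → length (g l) ≡ m × T (P (g l)))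
  (g∘f : ∀ l → T (P l) → g (f l) ≡ l)
  (f∘g : ∀ l → length l ≡ n → T (Q l) → f (g l) ≡ l)
  where

  to : VecWith m P → VecWith n Q
  to (v , p) = let (len , q) = f-into (toList v) (length-toList v) p in fromListWith Q (f (toList v)) len q

  from : VecWith n Q → VecWith m P
  from (v , q) = let (len , p) = g-into (toList v) (length-toList v) q in fromListWith P (g (toList v)) len p

  toList-to : ∀ s → toList (proj₁ (to s)) ≡ f (toList (proj₁ s))
  toList-to (v , p) = toList-cast-fromList (f (toList v)) (proj₁ (f-into (toList v) (length-toList v) p))

  toList-from : ∀ t → toList (proj₁ (from t)) ≡ g (toList (proj₁ t))
  toList-from (v , q) = toList-cast-fromList (g (toList v)) (proj₁ (g-into (toList v) (length-toList v) q))

  to∘from : ∀ t → to (from t) ≡ t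
  to∘from t@(v , q) = VecWith-≡ Q (begin
    toList (proj₁ (to (from t)))  ≡⟨ toList-to (from t) ⟩
    f (toList (proj₁ (from t)))   ≡⟨ cong f (toList-from t) ⟩
    f (g (toList v))              ≡⟨ f∘g (toList v) (length-toList v) q ⟩
    toList v                      ∎)

  from∘to : ∀ s → from (to s) ≡ s
  from∘to s@(v , p) = VecWith-≡ P (begin
    toList (proj₁ (from (to s)))  ≡⟨ toList-from (to s) ⟩
    g (toList (proj₁ (to s)))     ≡⟨ cong g (toList-to s) ⟩
    g (f (toList v))              ≡⟨ g∘f (toList v) p ⟩
    toList v                      ∎)

  bijection : VecWith m P ⤖ VecWith n Q
  bijection = ↔⇒⤖ (mk↔ₛ′ to from to∘from from∘to)

lemma4p11 : (n : ℕ) → 2 ≤ n →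
    Σ (AscSeqG n ⤖ AscSeq (n ∸ 1)) (λ φ → (s : AscSeqG n) →
      (zeroCount (toList (proj₁ (Bijection.to φ s))) ≡ zeroCount (toList (proj₁ s)) ∸ 1)
      × (asc (toList (proj₁ (Bijection.to φ s))) ≡ asc (toList (proj₁ s)))
      × (zpair (toList (proj₁ (Bijection.to φ s))) ≡ zpair (toList (proj₁ s))))
lemma4p11 (suc (suc k)) (s≤s (s≤s z≤n)) = bijection , λ s →
  let l = toList (proj₁ s)
      inG-l = proj₂ (Equivalence.to (T-∧ {isAscent l}) (proj₂ s))
  in DropZero-statistics (subst (DropZero _ l) (sym (toList-to s)) (DropZero-φ l inG-l))
  where open LiftToVec φ φ⁻¹ (φ-into k) (φ⁻¹-into k) φ⁻¹∘φ (φ∘φ⁻¹ k)
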